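{- Let $r\geq 3$ and $n=3r-2$. Then the $2$-packing number of the Kneser graph $K(n,r)$ is $$\rho(K(n,r))=\begin{cases}7, & \text{if } r=3,\\ 5, & \text{if } r=4,\\ 3, & \text{if } r\geq 5.\end{cases}$$
   Context: For positive integers $n\geq 2r$, the Kneser graph $K(n,r)$ has as vertices the $r$-subsets of $[n]=\{1,\dots,n\}$, two vertices being adjacent iff they are disjoint. For a vertex $v$, $N[v]$ denotes its closed neighbourhood (the vertex together with its neighbours). A $2$-packing of a graph $G$ is a set $S\subseteq V(G)$ such that $N[u]\cap N[v]=\emptyset$ for all distinct $u,v\in S$; the $2$-packing number $\rho(G)$ is the maximum cardinality of a $2$-packing of $G$. -}

module Defs where

open import Data.Nat using (ℕ; _≤_)
open import Data.Fin.Subset using (Subset; ∣_∣; _∩_; Empty)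
open import Data.List using (List; length)
open import Data.List.Relation.Unary.All using (All)
open import Data.List.Relation.Unary.Unique.Propositional using (Unique)
open import Data.List.Membership.Propositional using (_∈_)
open import Data.Product using (Σ; _×_)
open import Data.Sum using (_⊎_)
open import Relation.Binary.PropositionalEquality using (_≡_; _≢_)
open import Relation.Nullary using (¬_)

KAdj : {n : ℕ} → Subset n → Subset n → Set
KAdj s t = Empty (s ∩ t)

InClosedNbhd : (n r : ℕ) → Subset n → Subset n → Set
InClosedNbhd n r v w = ∣ w ∣ ≡ r × (w ≡ v ⊎ KAdj w v)

Is2Packing : (n r : ℕ) → List (Subset n) → Set
Is2Packing n r S =
  All (λ v → ∣ v ∣ ≡ r) S ×
  Unique S ×
  (∀ {u v} → u ∈ S → v ∈ S → u ≢ v →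
     ¬ (Σ (Subset n) λ w → InClosedNbhd n r u w × InClosedNbhd n r v w))

PackingNumberIs : (n r k : ℕ) → Set
PackingNumberIs n r k =
  (Σ (List (Subset n)) λ S → Is2Packing n r S × length S ≡ k) ×
  (∀ S → Is2Packing n r S → length S ≤ k)

{-# OPTIONS --safe #-}
-- In K(3r − 2, r) two r-sets meeting in at least two points leave at least r points outside their union,
-- hence have a common neighbour, while two distinct r-sets meeting in exactly one point have no common
-- closed neighbour. So a 2-packing is a family of r-sets pairwise meeting in at most one point, and any
-- family pairwise meeting in exactly one point is a 2-packing. For k such sets, if the point x lies in
-- d_x of them, then Σ d_x = k r and Σ C(d_x, 2) ≤ C(k, 2); with c d ≤ C(c + 1, 2) + C(d, 2) this gives
-- c k r ≤ C(c + 1, 2) n + C(k, 2), which excludes 8, 6 and 4 sets for r = 3, r = 4 and r ≥ 5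
-- (take c = 3, 2, 1). The lines of the Fano plane, the stars of K₅ and a triangle of r-sets attain the bounds.
module Submission where

open import Defs
open import Level using (0ℓ)
open import Data.Nat using (ℕ; zero; suc; _+_; _*_; _∸_; _≤_; _<_; z≤n; s≤s)
open import Data.Nat.Properties
open import Data.Nat.Combinatorics using (_C_; nC1≡n; nCk+nC[k+1]≡[n+1]C[k+1])
open import Data.Nat.ListAction using (sum)
open import Data.Nat.Tactic.RingSolver using (solve-∀)
open import Data.Bool using (true; false)
open import Data.Vec using ([]; _∷_; tail)
open import Data.Fin using (Fin; #_)
open import Data.Fin.Subset using (Subset; ∣_∣; _∩_; _∪_; ∁; ⊥; _⊆_; Empty; ⁅_⁆; ⋃)
open import Data.Fin.Subset.Properties
open import Data.List using (List; []; _∷_; length; map; take)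
open import Data.List.Properties using (length-take)
open import Data.List.Membership.Propositional using (_∈_)
open import Data.List.Relation.Unary.Any using (here; there)
open import Data.List.Relation.Unary.All as All using (All; []; _∷_; all?)
import Data.List.Relation.Unary.All.Properties as All
open import Data.List.Relation.Unary.AllPairs using (AllPairs; []; _∷_; allPairs?)
import Data.List.Relation.Unary.AllPairs.Properties as AllPairs
open import Data.List.Relation.Unary.Unique.Propositional using (Unique)
open import Data.Product using (Σ; _×_; _,_)
open import Data.Sum using (inj₁; inj₂; [_,_]′)
open import Relation.Binary.Core using (Rel)
open import Relation.Binary.Definitions using (Symmetric)
open import Relation.Binary.PropositionalEquality
open import Relation.Nullary using (¬_; yes; no; contradiction)
open import Relation.Nullary.Decidable using (from-yes)
open import Algebra.Properties.CommutativeSemigroup +-commutativeSemigroup using (interchange; x∙yz≈y∙xz)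

∣p∪q∣+∣p∩q∣≡∣p∣+∣q∣ : ∀ {n} (p q : Subset n) → ∣ p ∪ q ∣ + ∣ p ∩ q ∣ ≡ ∣ p ∣ + ∣ q ∣
∣p∪q∣+∣p∩q∣≡∣p∣+∣q∣ []          []          = refl
∣p∪q∣+∣p∩q∣≡∣p∣+∣q∣ (true ∷ p)  (true ∷ q)  =
  cong suc (trans (+-suc _ _) (trans (cong suc (∣p∪q∣+∣p∩q∣≡∣p∣+∣q∣ p q)) (sym (+-suc _ _))))
∣p∪q∣+∣p∩q∣≡∣p∣+∣q∣ (true ∷ p)  (false ∷ q) = cong suc (∣p∪q∣+∣p∩q∣≡∣p∣+∣q∣ p q)
∣p∪q∣+∣p∩q∣≡∣p∣+∣q∣ (false ∷ p) (true ∷ q)  =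
  trans (cong suc (∣p∪q∣+∣p∩q∣≡∣p∣+∣q∣ p q)) (sym (+-suc _ _))
∣p∪q∣+∣p∩q∣≡∣p∣+∣q∣ (false ∷ p) (false ∷ q) = ∣p∪q∣+∣p∩q∣≡∣p∣+∣q∣ p q

∣∁p∣+∣p∣≡n : ∀ {n} (p : Subset n) → ∣ ∁ p ∣ + ∣ p ∣ ≡ n
∣∁p∣+∣p∣≡n p = trans (cong (_+ ∣ p ∣) (∣∁p∣≡n∸∣p∣ p)) (m∸n+n≡m (∣p∣≤n p))

∣∁[p∪q]∣+2r≡n+∣p∩q∣ : ∀ {n r} (p q : Subset n) → ∣ p ∣ ≡ r → ∣ q ∣ ≡ r →
                      ∣ ∁ (p ∪ q) ∣ + 2 * r ≡ n + ∣ p ∩ q ∣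
∣∁[p∪q]∣+2r≡n+∣p∩q∣ {n} {r} p q ∣p∣≡r ∣q∣≡r = begin
  ∣ ∁ (p ∪ q) ∣ + 2 * r                       ≡⟨ cong (λ x → ∣ ∁ (p ∪ q) ∣ + (r + x)) (+-identityʳ r) ⟩
  ∣ ∁ (p ∪ q) ∣ + (r + r)                     ≡⟨ cong (∣ ∁ (p ∪ q) ∣ +_) (sym (cong₂ _+_ ∣p∣≡r ∣q∣≡r)) ⟩
  ∣ ∁ (p ∪ q) ∣ + (∣ p ∣ + ∣ q ∣)             ≡⟨ cong (∣ ∁ (p ∪ q) ∣ +_) (sym (∣p∪q∣+∣p∩q∣≡∣p∣+∣q∣ p q)) ⟩
  ∣ ∁ (p ∪ q) ∣ + (∣ p ∪ q ∣ + ∣ p ∩ q ∣)     ≡⟨ sym (+-assoc ∣ ∁ (p ∪ q) ∣ _ _) ⟩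
  ∣ ∁ (p ∪ q) ∣ + ∣ p ∪ q ∣ + ∣ p ∩ q ∣       ≡⟨ cong (_+ ∣ p ∩ q ∣) (∣∁p∣+∣p∣≡n (p ∪ q)) ⟩
  n + ∣ p ∩ q ∣                               ∎
  where open ≡-Reasoning

Empty⇒∣p∣≡0 : ∀ {n} {p : Subset n} → Empty p → ∣ p ∣ ≡ 0
Empty⇒∣p∣≡0 {n} empty = trans (cong ∣_∣ (Empty-unique empty)) (∣⊥∣≡0 n)

⊆∁⇒Empty∩ : ∀ {n} {p q : Subset n} → p ⊆ ∁ q → Empty (p ∩ q)
⊆∁⇒Empty∩ {p = p} {q} p⊆∁q (x , x∈p∩q) with x∈p∩q⁻ p q x∈p∩q
... | x∈p , x∈q = x∈∁p⇒x∉p (p⊆∁q x∈p) x∈q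

Empty∩⇒⊆∁[∪] : ∀ {n} {p q r : Subset n} → Empty (p ∩ q) → Empty (p ∩ r) → p ⊆ ∁ (q ∪ r)
Empty∩⇒⊆∁[∪] {q = q} {r} p∩q≡∅ p∩r≡∅ {x} x∈p = x∉p⇒x∈∁p λ x∈q∪r →
  [ (λ x∈q → p∩q≡∅ (x , x∈p∩q⁺ (x∈p , x∈q))) , (λ x∈r → p∩r≡∅ (x , x∈p∩q⁺ (x∈p , x∈r))) ]′
    (x∈p∪q⁻ q r x∈q∪r)

subset-of-size : ∀ {n} k (p : Subset n) → k ≤ ∣ p ∣ → Σ (Subset n) λ q → q ⊆ p × ∣ q ∣ ≡ k
subset-of-size {n} zero p _ = ⊥ , ⊥⊆ , ∣⊥∣≡0 n
subset-of-size (suc k) (true ∷ p) (s≤s k≤∣p∣) with subset-of-size k p k≤∣p∣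
... | q , q⊆p , ∣q∣≡k = true ∷ q , s⊆s q⊆p , cong suc ∣q∣≡k
subset-of-size (suc k) (false ∷ p) k<∣p∣ with subset-of-size (suc k) p k<∣p∣
... | q , q⊆p , ∣q∣≡k = false ∷ q , s⊆s q⊆p , ∣q∣≡k

KAdj-sym : ∀ {n} {u v : Subset n} → KAdj u v → KAdj v u
KAdj-sym {u = u} {v} = subst Empty (∩-comm u v)

CommonClosedNeighbour : (n r : ℕ) → Subset n → Subset n → Set
CommonClosedNeighbour n r u v = Σ (Subset n) λ w → InClosedNbhd n r u w × InClosedNbhd n r v w

commonClosedNeighbour : ∀ {n r} {u v : Subset n} → ∣ u ∣ ≡ r → ∣ v ∣ ≡ r →
                        3 * r ≤ n + ∣ u ∩ v ∣ → CommonClosedNeighbour n r u v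
commonClosedNeighbour {n} {r} {u} {v} ∣u∣≡r ∣v∣≡r 3r≤n+∣u∩v∣ =
  let w , w⊆∁[u∪v] , ∣w∣≡r = subset-of-size r (∁ (u ∪ v)) r≤∣∁[u∪v]∣
      disjoint : ∀ {x} → x ⊆ u ∪ v → KAdj w x
      disjoint x⊆u∪v = ⊆∁⇒Empty∩ (⊆-trans w⊆∁[u∪v] (p⊆q⇒∁p⊇∁q x⊆u∪v))
  in w , (∣w∣≡r , inj₂ (disjoint (p⊆p∪q v))) , (∣w∣≡r , inj₂ (disjoint (q⊆p∪q u v)))
  where
  r≤∣∁[u∪v]∣ : r ≤ ∣ ∁ (u ∪ v) ∣
  r≤∣∁[u∪v]∣ = +-cancelʳ-≤ (2 * r) r _
    (≤-trans 3r≤n+∣u∩v∣ (≤-reflexive (sym (∣∁[p∪q]∣+2r≡n+∣p∩q∣ u v ∣u∣≡r ∣v∣≡r))))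

noCommonClosedNeighbour : ∀ {n r} {u v : Subset n} → ∣ u ∣ ≡ r → ∣ v ∣ ≡ r →
                          n + ∣ u ∩ v ∣ < 3 * r → u ≢ v → ¬ KAdj u v →
                          ¬ CommonClosedNeighbour n r u v
noCommonClosedNeighbour _ _ _ u≢v _ (_ , (_ , inj₁ refl) , (_ , inj₁ u≡v)) = u≢v u≡v
noCommonClosedNeighbour _ _ _ _ ¬u∼v (_ , (_ , inj₁ refl) , (_ , inj₂ u∼v)) = ¬u∼v u∼v
noCommonClosedNeighbour _ _ _ _ ¬u∼v (_ , (_ , inj₂ v∼u) , (_ , inj₁ refl)) = ¬u∼v (KAdj-sym v∼u)
noCommonClosedNeighbour {n} {r} {u} {v} ∣u∣≡r ∣v∣≡r n+∣u∩v∣<3r _ _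
  (w , (∣w∣≡r , inj₂ w∼u) , (_ , inj₂ w∼v)) = <⇒≱ n+∣u∩v∣<3r (begin
    r + 2 * r                 ≤⟨ +-monoˡ-≤ (2 * r) r≤∣∁[u∪v]∣ ⟩
    ∣ ∁ (u ∪ v) ∣ + 2 * r     ≡⟨ ∣∁[p∪q]∣+2r≡n+∣p∩q∣ u v ∣u∣≡r ∣v∣≡r ⟩
    n + ∣ u ∩ v ∣             ∎)
  where
  open ≤-Reasoning
  r≤∣∁[u∪v]∣ : r ≤ ∣ ∁ (u ∪ v) ∣
  r≤∣∁[u∪v]∣ = subst (_≤ ∣ ∁ (u ∪ v) ∣) ∣w∣≡r (p⊆q⇒∣p∣≤∣q∣ (Empty∩⇒⊆∁[∪] w∼u w∼v))

[1+n]C2≡n+nC2 : ∀ n → suc n C 2 ≡ n + n C 2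
[1+n]C2≡n+nC2 n = trans (sym (nCk+nC[k+1]≡[n+1]C[k+1] n 1)) (cong (_+ n C 2) (nC1≡n n))

m*n≤[1+m]C2+nC2 : ∀ m n → m * n ≤ suc m C 2 + n C 2
m*n≤[1+m]C2+nC2 zero    n       = z≤n
m*n≤[1+m]C2+nC2 (suc m) zero    = ≤-trans (≤-reflexive (*-zeroʳ m)) z≤n
m*n≤[1+m]C2+nC2 (suc m) (suc n) = begin
  suc m * suc n                              ≡⟨ cong (suc n +_) (*-suc m n) ⟩
  suc n + (m + m * n)                        ≤⟨ +-monoʳ-≤ (suc n) (+-monoʳ-≤ m (m*n≤[1+m]C2+nC2 m n)) ⟩
  suc n + (m + (suc m C 2 + n C 2))          ≡⟨ regroup n m (suc m C 2) (n C 2) ⟩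
  (suc m + suc m C 2) + (n + n C 2)          ≡⟨ sym (cong₂ _+_ ([1+n]C2≡n+nC2 (suc m)) ([1+n]C2≡n+nC2 n)) ⟩
  suc (suc m) C 2 + suc n C 2                ∎
  where
  open ≤-Reasoning
  regroup : ∀ n m a b → suc n + (m + (a + b)) ≡ (suc m + a) + (n + b)
  regroup = solve-∀

module _ {n : ℕ} where

  totalSize : List (Subset n) → ℕ
  totalSize L = sum (map ∣_∣ L)

  overlapsWith : Subset n → List (Subset n) → ℕ
  overlapsWith p L = sum (map (λ q → ∣ p ∩ q ∣) L)

  pairOverlaps : List (Subset n) → ℕ
  pairOverlaps []      = 0
  pairOverlaps (p ∷ L) = overlapsWith p L + pairOverlaps L

degree : ∀ {n} → List (Subset (suc n)) → ℕ
degree []                = 0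
degree ((true  ∷ _) ∷ L) = suc (degree L)
degree ((false ∷ _) ∷ L) = degree L

totalSize-tail : ∀ {n} (L : List (Subset (suc n))) → totalSize L ≡ degree L + totalSize (map tail L)
totalSize-tail []                = refl
totalSize-tail ((true  ∷ p) ∷ L) = cong suc (trans (cong (∣ p ∣ +_) (totalSize-tail L)) (x∙yz≈y∙xz ∣ p ∣ (degree L) _))
totalSize-tail ((false ∷ p) ∷ L) = trans (cong (∣ p ∣ +_) (totalSize-tail L)) (x∙yz≈y∙xz ∣ p ∣ (degree L) _)

overlapsWith-true : ∀ {n} (p : Subset n) L → overlapsWith (true ∷ p) L ≡ degree L + overlapsWith p (map tail L)
overlapsWith-true p []                = refl
overlapsWith-true p ((true  ∷ q) ∷ L) =
  cong suc (trans (cong (∣ p ∩ q ∣ +_) (overlapsWith-true p L)) (x∙yz≈y∙xz ∣ p ∩ q ∣ (degree L) _))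
overlapsWith-true p ((false ∷ q) ∷ L) =
  trans (cong (∣ p ∩ q ∣ +_) (overlapsWith-true p L)) (x∙yz≈y∙xz ∣ p ∩ q ∣ (degree L) _)

overlapsWith-false : ∀ {n} (p : Subset n) L → overlapsWith (false ∷ p) L ≡ overlapsWith p (map tail L)
overlapsWith-false p []           = refl
overlapsWith-false p ((_ ∷ q) ∷ L) = cong (∣ p ∩ q ∣ +_) (overlapsWith-false p L)

pairOverlaps-tail : ∀ {n} (L : List (Subset (suc n))) →
                    pairOverlaps L ≡ degree L C 2 + pairOverlaps (map tail L)
pairOverlaps-tail []                = refl
pairOverlaps-tail ((true ∷ p) ∷ L)  = begin
  overlapsWith (true ∷ p) L + pairOverlaps L
    ≡⟨ cong₂ _+_ (overlapsWith-true p L) (pairOverlaps-tail L) ⟩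
  (degree L + overlapsWith p (map tail L)) + (degree L C 2 + pairOverlaps (map tail L))
    ≡⟨ interchange (degree L) _ _ _ ⟩
  (degree L + degree L C 2) + pairOverlaps (p ∷ map tail L)
    ≡⟨ cong (_+ pairOverlaps (p ∷ map tail L)) (sym ([1+n]C2≡n+nC2 (degree L))) ⟩
  suc (degree L) C 2 + pairOverlaps (p ∷ map tail L)
    ∎
  where open ≡-Reasoning
pairOverlaps-tail ((false ∷ p) ∷ L) = begin
  overlapsWith (false ∷ p) L + pairOverlaps L
    ≡⟨ cong₂ _+_ (overlapsWith-false p L) (pairOverlaps-tail L) ⟩
  overlapsWith p (map tail L) + (degree L C 2 + pairOverlaps (map tail L))
    ≡⟨ x∙yz≈y∙xz (overlapsWith p (map tail L)) (degree L C 2) _ ⟩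
  degree L C 2 + pairOverlaps (p ∷ map tail L)
    ∎
  where open ≡-Reasoning

totalSize-Subset0 : (L : List (Subset 0)) → totalSize L ≡ 0
totalSize-Subset0 []       = refl
totalSize-Subset0 ([] ∷ L) = totalSize-Subset0 L

double-counting : ∀ c n (L : List (Subset n)) → c * totalSize L ≤ (suc c C 2) * n + pairOverlaps L
double-counting c zero L = ≤-trans (≤-reflexive (trans (cong (c *_) (totalSize-Subset0 L)) (*-zeroʳ c))) z≤n
double-counting c (suc n) L = begin
  c * totalSize L                              ≡⟨ cong (c *_) (totalSize-tail L) ⟩
  c * (d + totalSize L′)                       ≡⟨ *-distribˡ-+ c d _ ⟩
  c * d + c * totalSize L′                     ≤⟨ +-mono-≤ (m*n≤[1+m]C2+nC2 c d) (double-counting c n L′) ⟩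
  (K + d C 2) + (K * n + pairOverlaps L′)      ≡⟨ interchange K _ _ _ ⟩
  (K + K * n) + (d C 2 + pairOverlaps L′)      ≡⟨ cong₂ _+_ (sym (*-suc K n)) (sym (pairOverlaps-tail L)) ⟩
  K * suc n + pairOverlaps L                   ∎
  where
  open ≤-Reasoning
  d  = degree L
  L′ = map tail L
  K  = suc c C 2

totalSize-uniform : ∀ {n r} (L : List (Subset n)) → All (λ p → ∣ p ∣ ≡ r) L → totalSize L ≡ length L * r
totalSize-uniform []      []            = refl
totalSize-uniform (_ ∷ L) (∣p∣≡r ∷ ∣L∣≡r) = cong₂ _+_ ∣p∣≡r (totalSize-uniform L ∣L∣≡r)

pairOverlaps≤ : ∀ {n} (L : List (Subset n)) → AllPairs (λ p q → ∣ p ∩ q ∣ ≤ 1) L → pairOverlaps L ≤ length L C 2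
pairOverlaps≤ []      []         = z≤n
pairOverlaps≤ (p ∷ L) (p≤1 ∷ L≤1) = begin
  overlapsWith p L + pairOverlaps L   ≤⟨ +-mono-≤ (overlapsWith≤ L p≤1) (pairOverlaps≤ L L≤1) ⟩
  length L + length L C 2             ≡⟨ sym ([1+n]C2≡n+nC2 (length L)) ⟩
  suc (length L) C 2                  ∎
  where
  open ≤-Reasoning
  overlapsWith≤ : ∀ L → All (λ q → ∣ p ∩ q ∣ ≤ 1) L → overlapsWith p L ≤ length L
  overlapsWith≤ []      []        = z≤n
  overlapsWith≤ (_ ∷ L) (q≤1 ∷ L≤1) = +-mono-≤ q≤1 (overlapsWith≤ L L≤1)

linearFamily-bound : ∀ c {n r} (L : List (Subset n)) → All (λ p → ∣ p ∣ ≡ r) L →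
                     AllPairs (λ p q → ∣ p ∩ q ∣ ≤ 1) L →
                     c * (length L * r) ≤ (suc c C 2) * n + length L C 2
linearFamily-bound c {n} L ∣L∣≡r L≤1 = begin
  c * (length L * _)                 ≡⟨ cong (c *_) (sym (totalSize-uniform L ∣L∣≡r)) ⟩
  c * totalSize L                    ≤⟨ double-counting c n L ⟩
  (suc c C 2) * n + pairOverlaps L   ≤⟨ +-monoʳ-≤ ((suc c C 2) * n) (pairOverlaps≤ L L≤1) ⟩
  (suc c C 2) * n + length L C 2     ∎
  where open ≤-Reasoning

module _ {a ℓ} {A : Set a} {R : Rel A ℓ} where

  allPairs-lookup : Symmetric R → ∀ {xs} → AllPairs R xs →
                    ∀ {x y} → x ∈ xs → y ∈ xs → x ≢ y → R x y
  allPairs-lookup sym (_ ∷ _)  (here refl) (here refl) x≢y = contradiction refl x≢y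
  allPairs-lookup sym (Rx ∷ _) (here refl) (there y∈) _    = All.lookup Rx y∈
  allPairs-lookup sym (Ry ∷ _) (there x∈) (here refl) _    = sym (All.lookup Ry x∈)
  allPairs-lookup sym (_ ∷ R*) (there x∈) (there y∈) x≢y  = allPairs-lookup sym R* x∈ y∈ x≢y

  allPairs-tabulate : ∀ {xs} → (∀ {x y} → x ∈ xs → y ∈ xs → x ≢ y → R x y) → Unique xs → AllPairs R xs
  allPairs-tabulate {[]}     _ []            = []
  allPairs-tabulate {x ∷ xs} R-∈ (x≢xs ∷ !xs) =
    All.tabulate (λ y∈ → R-∈ (here refl) (there y∈) (All.lookup x≢xs y∈)) ∷
    allPairs-tabulate (λ x∈ y∈ → R-∈ (there x∈) (there y∈)) !xs

MeetInAtMostOne MeetInOne : ∀ {n} → Rel (Subset n) 0ℓ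
MeetInAtMostOne p q = ∣ p ∩ q ∣ ≤ 1
MeetInOne       p q = ∣ p ∩ q ∣ ≡ 1

packing⇒meetInAtMostOne : ∀ {n r S} → 3 * r ≤ n + 2 → Is2Packing n r S → AllPairs MeetInAtMostOne S
packing⇒meetInAtMostOne {n} {r} {S} 3r≤n+2 (∣S∣≡r , unique , disjointNbhds) = allPairs-tabulate meet≤1 unique
  where
  meet≤1 : ∀ {u v} → u ∈ S → v ∈ S → u ≢ v → MeetInAtMostOne u v
  meet≤1 {u} {v} u∈ v∈ u≢v with ∣ u ∩ v ∣ ≤? 1
  ... | yes ∣u∩v∣≤1 = ∣u∩v∣≤1
  ... | no  ∣u∩v∣≰1 = contradiction
    (commonClosedNeighbour (All.lookup ∣S∣≡r u∈) (All.lookup ∣S∣≡r v∈)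
      (≤-trans 3r≤n+2 (+-monoʳ-≤ n (≰⇒> ∣u∩v∣≰1))))
    (disjointNbhds u∈ v∈ u≢v)

meetInOne⇒packing : ∀ {n r L} → 2 ≤ r → n + 2 ≤ 3 * r →
                    All (λ p → ∣ p ∣ ≡ r) L → AllPairs MeetInOne L → Is2Packing n r L
meetInOne⇒packing {n} {r} {L} 2≤r n+2≤3r ∣L∣≡r L-meet = ∣L∣≡r , unique L ∣L∣≡r L-meet , disjointNbhds
  where
  meetInOne⇒≢ : ∀ {p q} → ∣ p ∣ ≡ r → MeetInOne p q → p ≢ q
  meetInOne⇒≢ {p} ∣p∣≡r ∣p∩q∣≡1 refl = <⇒≢ 2≤r (trans (sym ∣p∩q∣≡1) (trans (cong ∣_∣ (∩-idem p)) ∣p∣≡r))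
  unique : ∀ L → All (λ p → ∣ p ∣ ≡ r) L → AllPairs MeetInOne L → Unique L
  unique []      []              []                = []
  unique (_ ∷ L) (∣p∣≡r ∷ ∣L∣≡r) (p-meet ∷ L-meet) =
    All.map (meetInOne⇒≢ ∣p∣≡r) p-meet ∷ unique L ∣L∣≡r L-meet
  disjointNbhds : ∀ {u v} → u ∈ L → v ∈ L → u ≢ v → ¬ CommonClosedNeighbour n r u v
  disjointNbhds {u} {v} u∈ v∈ u≢v =
    noCommonClosedNeighbour (All.lookup ∣L∣≡r u∈) (All.lookup ∣L∣≡r v∈)
      (subst (λ k → n + k < 3 * r) (sym ∣u∩v∣≡1) (≤-trans (≤-reflexive (sym (+-suc n 1))) n+2≤3r)) u≢v
      (λ u∼v → 1+n≢0 (trans (sym ∣u∩v∣≡1) (Empty⇒∣p∣≡0 u∼v)))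
    where
    ∣u∩v∣≡1 : MeetInOne u v
    ∣u∩v∣≡1 = allPairs-lookup (λ {p} {q} e → trans (cong ∣_∣ (∩-comm q p)) e) L-meet u∈ v∈ u≢v

packing-length≤ : ∀ {n r} c k → 3 * r ≤ n + 2 →
                  (suc c C 2) * n + suc k C 2 < c * (suc k * r) →
                  ∀ S → Is2Packing n r S → length S ≤ k
packing-length≤ {n} {r} c k 3r≤n+2 tooMany S packing@(∣S∣≡r , _) = ≮⇒≥ λ k<∣S∣ →
  <⇒≱ tooMany (subst (λ m → c * (m * r) ≤ (suc c C 2) * n + m C 2)
                     (trans (length-take (suc k) S) (m≤n⇒m⊓n≡m k<∣S∣))
                     (linearFamily-bound c (take (suc k) S)
                       (All.take⁺ (suc k) ∣S∣≡r)
                       (AllPairs.take⁺ (suc k) (packing⇒meetInAtMostOne 3r≤n+2 packing))))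

packingNumber : ∀ {n r} → n + 2 ≡ 3 * r → 2 ≤ r →
                (L : List (Subset n)) → All (λ p → ∣ p ∣ ≡ r) L → AllPairs MeetInOne L →
                (c : ℕ) → (suc c C 2) * n + suc (length L) C 2 < c * (suc (length L) * r) →
                PackingNumberIs n r (length L)
packingNumber n+2≡3r 2≤r L ∣L∣≡r L-meet c tooMany =
  (L , meetInOne⇒packing 2≤r (≤-reflexive n+2≡3r) ∣L∣≡r L-meet , refl) ,
  packing-length≤ c (length L) (≤-reflexive (sym n+2≡3r)) tooMany

points : ∀ {n} → List (Fin n) → Subset n
points xs = ⋃ (map ⁅_⁆ xs)

fanoLines : List (Subset 7)
fanoLines = points (# 0 ∷ # 1 ∷ # 2 ∷ []) ∷ points (# 0 ∷ # 3 ∷ # 4 ∷ []) ∷ points (# 0 ∷ # 5 ∷ # 6 ∷ []) ∷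
            points (# 1 ∷ # 3 ∷ # 5 ∷ []) ∷ points (# 1 ∷ # 4 ∷ # 6 ∷ []) ∷ points (# 2 ∷ # 3 ∷ # 6 ∷ []) ∷
            points (# 2 ∷ # 4 ∷ # 5 ∷ []) ∷ []

fano-packing : PackingNumberIs 7 3 7
fano-packing = packingNumber refl (s≤s (s≤s z≤n)) fanoLines
  (from-yes (all? (λ p → ∣ p ∣ ≟ 3) fanoLines))
  (from-yes (allPairs? (λ p q → ∣ p ∩ q ∣ ≟ 1) fanoLines))
  3 (from-yes (70 <? 72))

-- The stars of the vertices of K₅, its edges 01, 02, 03, 04, 12, 13, 14, 23, 24, 34 being the points 0, …, 9.
k₅Stars : List (Subset 10)
k₅Stars = points (# 0 ∷ # 1 ∷ # 2 ∷ # 3 ∷ []) ∷ points (# 0 ∷ # 4 ∷ # 5 ∷ # 6 ∷ []) ∷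
          points (# 1 ∷ # 4 ∷ # 7 ∷ # 8 ∷ []) ∷ points (# 2 ∷ # 5 ∷ # 7 ∷ # 9 ∷ []) ∷
          points (# 3 ∷ # 6 ∷ # 8 ∷ # 9 ∷ []) ∷ []

k₅Stars-packing : PackingNumberIs 10 4 5
k₅Stars-packing = packingNumber refl (s≤s (s≤s z≤n)) k₅Stars
  (from-yes (all? (λ p → ∣ p ∣ ≟ 4) k₅Stars))
  (from-yes (allPairs? (λ p q → ∣ p ∩ q ∣ ≟ 1) k₅Stars))
  2 (from-yes (45 <? 48))

-- For r = 2 the sets are {0,1}, {0,2}, {1,2}, with point 3 unused so that there are 3r − 2 points;
-- each step adds a private point to every set.
triangleHost : ℕ → ℕ
triangleHost zero    = 4
triangleHost (suc m) = 3 + triangleHost m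

triangleA triangleB triangleC : ∀ m → Subset (triangleHost m)
triangleA zero    = true  ∷ true  ∷ false ∷ false ∷ []
triangleA (suc m) = true  ∷ false ∷ false ∷ triangleA m
triangleB zero    = true  ∷ false ∷ true  ∷ false ∷ []
triangleB (suc m) = false ∷ true  ∷ false ∷ triangleB m
triangleC zero    = false ∷ true  ∷ true  ∷ false ∷ []
triangleC (suc m) = false ∷ false ∷ true  ∷ triangleC m

triangle : ∀ m → List (Subset (triangleHost m))
triangle m = triangleA m ∷ triangleB m ∷ triangleC m ∷ []

∣triangle∣ : ∀ m → All (λ p → ∣ p ∣ ≡ 2 + m) (triangle m)
∣triangle∣ zero = refl ∷ refl ∷ refl ∷ []
∣triangle∣ (suc m) with ∣triangle∣ m
... | ∣A∣ ∷ ∣B∣ ∷ ∣C∣ ∷ [] = cong suc ∣A∣ ∷ cong suc ∣B∣ ∷ cong suc ∣C∣ ∷ []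

triangle-meetInOne : ∀ m → AllPairs MeetInOne (triangle m)
triangle-meetInOne zero = (refl ∷ refl ∷ []) ∷ (refl ∷ []) ∷ [] ∷ []
triangle-meetInOne (suc m) with triangle-meetInOne m
... | (AB ∷ AC ∷ []) ∷ (BC ∷ []) ∷ [] ∷ [] = (AB ∷ AC ∷ []) ∷ (BC ∷ []) ∷ [] ∷ []

triangleHost+2≡3r : ∀ m → triangleHost m + 2 ≡ 3 * (2 + m)
triangleHost+2≡3r zero    = refl
triangleHost+2≡3r (suc m) = trans (cong (3 +_) (triangleHost+2≡3r m)) (sym (*-suc 3 (2 + m)))

-- The factors 1 are C(2, 2) and c of the bound in packingNumber for c = 1.
n+6<4r : ∀ {n r} → n + 2 ≡ 3 * r → 5 ≤ r → 1 * n + 6 < 1 * (4 * r)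
n+6<4r {n} {r} n+2≡3r 5≤r = begin-strict
  1 * n + 6      ≡⟨ cong (_+ 6) (*-identityˡ n) ⟩
  n + 6          ≡⟨ sym (+-assoc n 2 4) ⟩
  n + 2 + 4      ≡⟨ cong (_+ 4) n+2≡3r ⟩
  3 * r + 4      <⟨ +-monoʳ-< (3 * r) 5≤r ⟩
  3 * r + r      ≡⟨ +-comm (3 * r) r ⟩
  4 * r          ≡⟨ sym (*-identityˡ (4 * r)) ⟩
  1 * (4 * r)    ∎
  where open ≤-Reasoning

triangle-packing : ∀ m → 3 ≤ m → PackingNumberIs (3 * (2 + m) ∸ 2) (2 + m) 3
triangle-packing m 3≤m = subst (λ n → PackingNumberIs n (2 + m) 3) host≡3r∸2
  (packingNumber (triangleHost+2≡3r m) (s≤s (s≤s z≤n)) (triangle m) (∣triangle∣ m) (triangle-meetInOne m)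
    1 (n+6<4r (triangleHost+2≡3r m) (s≤s (s≤s 3≤m))))
  where
  host≡3r∸2 : triangleHost m ≡ 3 * (2 + m) ∸ 2
  host≡3r∸2 = trans (sym (m+n∸n≡m (triangleHost m) 2)) (cong (_∸ 2) (triangleHost+2≡3r m))

theorem4 : (r : ℕ) → 3 ≤ r →
    (r ≡ 3 → PackingNumberIs (3 * r ∸ 2) r 7) ×
    (r ≡ 4 → PackingNumberIs (3 * r ∸ 2) r 5) ×
    (5 ≤ r → PackingNumberIs (3 * r ∸ 2) r 3)
theorem4 r _ = (λ { refl → fano-packing }) , (λ { refl → k₅Stars-packing }) , large r
  where
  large : ∀ r → 5 ≤ r → PackingNumberIs (3 * r ∸ 2) r 3
  large (suc (suc m)) (s≤s (s≤s 3≤m)) = triangle-packing m 3≤m
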